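{- There is a universal constant $c$ such that for every positive integer $t$, if a graph $G$ contains a crossed $t$-grid as a subgraph, then $t\le c\cdot(\mathsf{hw}(G))^2$.
   Context: All graphs are finite, simple, undirected. $\mathsf{hw}(G)$ is the largest $s$ such that $K_s$ is a minor of $G$. For $t\ge1$, a crossed $t$-grid is any graph obtained as follows: take the $((t+2)\times(t+2))$-grid (vertex set $[t+2]\times[t+2]$, $(i,j)$ adjacent to $(i,j+1)$ and $(i+1,j)$), remove all edges both of whose endpoints have degree less than 4, subdivide each remaining edge at least once, and take the line graph of the result. -}

module Defs where

open import Data.Nat using (ℕ; zero; suc; _+_; _*_; _≤_; _<_; _<?_)
open import Data.Bool using (Bool; true; false; _∨_; _∧_; not; if_then_else_)
open import Data.Fin using (Fin; toℕ; fromℕ<) renaming (zero to fzero; suc to fsuc)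
open import Data.Maybe using (Maybe; just; nothing)
open import Data.Product using (Σ; ∃; _×_; _,_; proj₁; proj₂)
open import Data.Sum using (_⊎_; inj₁; inj₂)
open import Relation.Nullary using (¬_; yes; no)
open import Relation.Binary.PropositionalEquality using (_≡_; _≢_)
open import Function.Definitions using (Injective)

record Graph : Set₁ where
  field
    n     : ℕ
    Adj   : Fin n → Fin n → Set
    sym   : ∀ {u v} → Adj u v → Adj v u
    irrefl : ∀ {u} → ¬ Adj u u
open Graph public

data ConnIn (G : Graph) (P : Fin (n G) → Set) : Fin (n G) → Fin (n G) → Set where
  here : ∀ {u} → P u → ConnIn G P u u
  step : ∀ {u w v} → P u → Adj G u w → ConnIn G P w v → ConnIn G P u v

-- a K_s model: disjoint (via a partial labelling), nonempty, connected
-- branch sets, pairwise joined by an edge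
record KMinorModel (G : Graph) (s : ℕ) : Set where
  field
    branch    : Fin (n G) → Maybe (Fin s)
    nonempty  : ∀ (i : Fin s) → ∃ λ u → branch u ≡ just i
    connected : ∀ (i : Fin s) (u v : Fin (n G)) → branch u ≡ just i → branch v ≡ just i →
                ConnIn G (λ x → branch x ≡ just i) u v
    touching  : ∀ (i j : Fin s) → i ≢ j →
                ∃ λ u → ∃ λ v → branch u ≡ just i × branch v ≡ just j × Adj G u v

HasKMinor : Graph → ℕ → Set
HasKMinor G s = KMinorModel G s

IsHw : Graph → ℕ → Set
IsHw G h = HasKMinor G h × (∀ s → HasKMinor G s → s ≤ h)

ContainsSubgraph : (G : Graph) (V : Set) (A : V → V → Set) → Set
ContainsSubgraph G V A =
  Σ (V → Fin (n G)) λ f → Injective _≡_ _≡_ f × (∀ a b → A a b → Adj G (f a) (f b))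

-- The (t+2)×(t+2) grid (coordinates 0 .. t+1)

Pt : ℕ → Set
Pt t = Fin (suc (suc t)) × Fin (suc (suc t))

b2n : Bool → ℕ
b2n true = 1
b2n false = 0

ltb : ℕ → ℕ → Bool
ltb a b with a <? b
... | yes _ = true
... | no _ = false

gridDeg : ∀ t → Pt t → ℕ
gridDeg t (i , j) = b2n (ltb 0 (toℕ i)) + b2n (ltb (toℕ i) (suc t))
                  + b2n (ltb 0 (toℕ j)) + b2n (ltb (toℕ j) (suc t))

data GEdge (t : ℕ) : Set where
  horiz : Fin (suc (suc t)) → Fin (suc t) → GEdge t
  vert  : Fin (suc t) → Fin (suc (suc t)) → GEdge t

open import Data.Fin using (inject₁)

endA endB : ∀ {t} → GEdge t → Pt t
endA (horiz i j) = i , inject₁ j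
endA (vert i j)  = inject₁ i , j
endB (horiz i j) = i , fsuc j
endB (vert i j)  = fsuc i , j

kept : ∀ {t} → GEdge t → Bool
kept {t} e = not (ltb (gridDeg t (endA e)) 4 ∧ ltb (gridDeg t (endB e)) 4)

KEdge : ℕ → Set
KEdge t = Σ (GEdge t) λ e → kept e ≡ true

-- Subdivision: kept edge e is subdivided k e times (k e ≥ 1), giving
-- a path with k e + 1 segments.

module Crossed (t : ℕ) (k : KEdge t → ℕ) where

  -- vertices of the subdivided graph: original grid vertices and
  -- subdivision vertices
  SVert : Set
  SVert = Pt t ⊎ Σ (KEdge t) λ e → Fin (k e)

  -- edges (segments) of the subdivided graph = vertices of the line graph
  Seg : Set
  Seg = Σ (KEdge t) λ e → Fin (suc (k e))

  leftEnd : Seg → SVert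
  leftEnd (e , fzero)  = inj₁ (endA (proj₁ e))
  leftEnd (e , fsuc q) = inj₂ (e , q)

  rightEnd : Seg → SVert
  rightEnd (e , p) with toℕ p <? k e
  ... | yes p<k = inj₂ (e , fromℕ< p<k)
  ... | no _    = inj₁ (endB (proj₁ e))

  Incident : Seg → SVert → Set
  Incident s x = leftEnd s ≡ x ⊎ rightEnd s ≡ x

  LAdj : Seg → Seg → Set
  LAdj a b = a ≢ b × ∃ λ x → Incident a x × Incident b x

ContainsCrossedGrid : Graph → ℕ → Set
ContainsCrossedGrid G t =
  Σ (KEdge t → ℕ) λ k → (∀ e → 1 ≤ k e) ×
    ContainsSubgraph G (Crossed.Seg t k) (Crossed.LAdj t k)

-- The crossed t-grid already contains K_t as a minor, so t ≤ hw(G) ≤ hw(G)² and c = 1 works.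
-- The r-th branch set consists of the segments (vertices of the line graph) lying on the
-- (r+1)-st row and the (r+1)-st column of the grid. Consecutive segments of a row share a
-- vertex, so a row is connected in the line graph, and so is a column. At the grid point
-- (r+1, r'+1) the last segment of the row edge entering it from the left and the last
-- segment of the column edge entering it from above share that point; for r = r' this joins
-- row r to column r, for r ≠ r' it joins branch sets r and r'. All these grid edges survive
-- the deletion step, since each of them has an endpoint (r+1, r'+1) of degree 4.
module Submission where

open import Defs hiding (sym)
open import Data.Nat using (ℕ; zero; suc; _+_; _*_; _≤_; _<_; _<?_; z≤n; s≤s)
open import Data.Nat.Properties using (≤-trans; m≤m*n; *-identityˡ; n≮n)
open import Data.Bool using (true; false; not; _∧_)
open import Data.Bool.Properties using (∧-zeroʳ) renaming (_≟_ to _≟ᵇ_)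
open import Data.Fin using (Fin; toℕ; inject₁; fromℕ) renaming (zero to fzero; suc to fsuc)
open import Data.Fin.Properties using (any?; toℕ-inject₁; inject₁ℕ<; toℕ-fromℕ; toℕ-fromℕ<; toℕ-injective; suc-injective) renaming (_≟_ to _≟ᶠ_)
open import Data.Fin.Induction using (<-weakInduction)
open import Data.Maybe using (Maybe; just; nothing)
import Data.Maybe as Maybe
open import Data.Product using (Σ; ∃; ∃₂; _×_; _,_; proj₁; proj₂)
open import Data.Sum using (_⊎_; inj₁; inj₂)
open import Function using (_∘_)
open import Relation.Nullary using (Dec; yes; no; contradiction)
open import Relation.Nullary.Decidable using (map′; _⊎-dec_)
open import Relation.Unary using (Decidable)
open import Relation.Binary.PropositionalEquality using (_≡_; _≢_; refl; sym; trans; cong; subst)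
open import Relation.Binary.Construct.Closure.ReflexiveTransitive using (Star; ε; _◅_; _◅◅_; reverse)
open import Axiom.UniquenessOfIdentityProofs using (module Decidable⇒UIP)

Searchable : Set → Set₁
Searchable A = ∀ {P : A → Set} → Decidable P → Dec (∃ P)

searchable-Fin : ∀ {m} → Searchable (Fin m)
searchable-Fin = any?

searchable-Σ : ∀ {A : Set} {B : A → Set} → Searchable A → (∀ a → Searchable (B a)) → Searchable (Σ A B)
searchable-Σ searchA searchB P? =
  map′ (λ (a , b , p) → (a , b) , p) (λ ((a , b) , p) → a , b , p)
       (searchA (λ a → searchB a (λ b → P? (a , b))))

searchable-≡true : ∀ b → Searchable (b ≡ true)
searchable-≡true true P? = map′ (refl ,_) (λ { (refl , p) → p }) (P? refl)
searchable-≡true false P? = no λ { (() , _) }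

searchable-GEdge : ∀ {t} → Searchable (GEdge t)
searchable-GEdge {P = P} P? =
  map′ from to (searchable-Fin (λ i → searchable-Fin (P? ∘ horiz i))
                ⊎-dec searchable-Fin (λ i → searchable-Fin (P? ∘ vert i)))
  where
  ByKind : Set
  ByKind = (∃₂ λ i j → P (horiz i j)) ⊎ (∃₂ λ i j → P (vert i j))
  from : ByKind → ∃ P
  from (inj₁ (i , j , p)) = horiz i j , p
  from (inj₂ (i , j , p)) = vert i j , p
  to : ∃ P → ByKind
  to (horiz i j , p) = inj₁ (i , j , p)
  to (vert i j , p) = inj₂ (i , j , p)

Within : {V : Set} → (V → Set) → (V → V → Set) → V → V → Set
Within Q A a b = Q a × Q b × A a b

record KMinorModelIn {V : Set} (A : V → V → Set) (s : ℕ) : Set where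
  field
    label     : V → Maybe (Fin s)
    nonempty  : ∀ i → ∃ λ a → label a ≡ just i
    connected : ∀ i a b → label a ≡ just i → label b ≡ just i →
                Star (Within (λ x → label x ≡ just i) A) a b
    touching  : ∀ i j → i ≢ j → ∃₂ λ a b → label a ≡ just i × label b ≡ just j × A a b

kMinor-of-subgraph : ∀ {G : Graph} {V : Set} {A : V → V → Set} {s} → Searchable V →
                     ContainsSubgraph G V A → KMinorModelIn A s → HasKMinor G s
kMinor-of-subgraph {G} {V} {A} {s} search (f , f-injective , f-adj) M = record
  { branch    = branch
  ; nonempty  = λ i → let a , ℓa = nonempty i in f a , trans (branch-f a) ℓa
  ; connected = connectedᴳ
  ; touching  = λ i j i≢j → let a , b , ℓa , ℓb , ab = touching i j i≢j in
                  f a , f b , trans (branch-f a) ℓa , trans (branch-f b) ℓb , f-adj a b ab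
  }
  where
  open KMinorModelIn M

  branch : Fin (n G) → Maybe (Fin s)
  branch u with search (λ a → f a ≟ᶠ u)
  ... | yes (a , _) = label a
  ... | no _        = nothing

  branch-f : ∀ a → branch (f a) ≡ label a
  branch-f a with search (λ a′ → f a′ ≟ᶠ f a)
  ... | yes (a′ , fa′≡fa) = cong label (f-injective fa′≡fa)
  ... | no ∄a′            = contradiction (a , refl) ∄a′

  branch-just : ∀ {u i} → branch u ≡ just i → ∃ λ a → f a ≡ u × label a ≡ just i
  branch-just {u} with search (λ a → f a ≟ᶠ u)
  ... | yes (a , fa≡u) = λ ℓa → a , fa≡u , ℓa
  ... | no _           = λ ()

  walk : ∀ {i a b} → label a ≡ just i → Star (Within (λ x → label x ≡ just i) A) a b →
         ConnIn G (λ x → branch x ≡ just i) (f a) (f b)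
  walk {a = a} ℓa ε = here (trans (branch-f a) ℓa)
  walk {a = a} ℓa ((_ , ℓb , ab) ◅ w) = step (trans (branch-f a) ℓa) (f-adj _ _ ab) (walk ℓb w)

  connectedᴳ : ∀ i u v → branch u ≡ just i → branch v ≡ just i →
               ConnIn G (λ x → branch x ≡ just i) u v
  connectedᴳ i u v bu bv with branch-just bu | branch-just bv
  ... | a , refl , ℓa | b , refl , ℓb = walk ℓa (connected i a b ℓa ℓb)

star-chain : ∀ {m} {A : Set} {R : A → A → Set} (g : Fin (suc m) → A) →
             (∀ i → Star R (g (fsuc i)) (g (inject₁ i))) → ∀ p → Star R (g p) (g fzero)
star-chain {R = R} g link = <-weakInduction (λ p → Star R (g p) (g fzero)) ε (λ i w → link i ◅◅ w)

inject₁≢fsuc : ∀ {m} (i : Fin m) → inject₁ i ≢ fsuc i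
inject₁≢fsuc fzero ()
inject₁≢fsuc (fsuc i) eq = inject₁≢fsuc i (suc-injective eq)

inject₁⁻¹ : ∀ {m} → Fin (suc m) → Maybe (Fin m)
inject₁⁻¹ {zero} _ = nothing
inject₁⁻¹ {suc m} fzero = just fzero
inject₁⁻¹ {suc m} (fsuc i) = Maybe.map fsuc (inject₁⁻¹ i)

inject₁⁻¹-inject₁ : ∀ {m} (i : Fin m) → inject₁⁻¹ (inject₁ i) ≡ just i
inject₁⁻¹-inject₁ fzero = refl
inject₁⁻¹-inject₁ (fsuc i) rewrite inject₁⁻¹-inject₁ i = refl

inject₁⁻¹-just : ∀ {m} (i : Fin (suc m)) {r} → inject₁⁻¹ i ≡ just r → i ≡ inject₁ r
inject₁⁻¹-just {suc m} fzero refl = refl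
inject₁⁻¹-just {suc m} (fsuc i) eq with inject₁⁻¹ i in eqᵢ
inject₁⁻¹-just {suc m} (fsuc i) refl | just r = cong fsuc (inject₁⁻¹-just i eqᵢ)

inner : ∀ {t} → Fin t → Fin (suc (suc t))
inner r = fsuc (inject₁ r)

innerIndex : ∀ {t} → Fin (suc (suc t)) → Maybe (Fin t)
innerIndex fzero = nothing
innerIndex (fsuc i) = inject₁⁻¹ i

innerIndex-inner : ∀ {t} (r : Fin t) → innerIndex (inner r) ≡ just r
innerIndex-inner = inject₁⁻¹-inject₁

innerIndex-just : ∀ {t} (i : Fin (suc (suc t))) {r} → innerIndex i ≡ just r → i ≡ inner r
innerIndex-just (fsuc i) eq = cong fsuc (inject₁⁻¹-just i eq)

ltb-true : ∀ {a b} → a < b → ltb a b ≡ true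
ltb-true {a} {b} a<b with a <? b
... | yes _   = refl
... | no a≮b = contradiction a<b a≮b

b2n-sum-true : ∀ {a b c d} → a ≡ true → b ≡ true → c ≡ true → d ≡ true →
               b2n a + b2n b + b2n c + b2n d ≡ 4
b2n-sum-true refl refl refl refl = refl

gridDeg-inner : ∀ {t} (r r′ : Fin t) → gridDeg t (inner r , inner r′) ≡ 4
gridDeg-inner r r′ =
  b2n-sum-true (ltb-true {0} {toℕ (inner r)} (s≤s z≤n)) (ltb-true (s≤s (inject₁ℕ< r)))
               (ltb-true {0} {toℕ (inner r′)} (s≤s z≤n)) (ltb-true (s≤s (inject₁ℕ< r′)))

inner-not-low-degree : ∀ {t} {r r′ : Fin t} → ltb (gridDeg t (inner r , inner r′)) 4 ≡ false
inner-not-low-degree {r = r} {r′} = cong (λ d → ltb d 4) (gridDeg-inner r r′)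

not-∧-falseˡ : ∀ {a} b → a ≡ false → not (a ∧ b) ≡ true
not-∧-falseˡ _ refl = refl

not-∧-falseʳ : ∀ a {b} → b ≡ false → not (a ∧ b) ≡ true
not-∧-falseʳ a refl = cong not (∧-zeroʳ a)

kept-endA-inner : ∀ {t} (e : GEdge t) {r r′} → endA e ≡ (inner r , inner r′) → kept e ≡ true
kept-endA-inner {t} e {r} {r′} eq =
  not-∧-falseˡ _ (trans (cong (λ x → ltb (gridDeg t x) 4) eq) (inner-not-low-degree {r = r} {r′}))

kept-endB-inner : ∀ {t} (e : GEdge t) {r r′} → endB e ≡ (inner r , inner r′) → kept e ≡ true
kept-endB-inner {t} e {r} {r′} eq =
  not-∧-falseʳ _ (trans (cong (λ x → ltb (gridDeg t x) 4) eq) (inner-not-low-degree {r = r} {r′}))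

row-kept : ∀ {t} (r : Fin t) j → kept (horiz (inner r) j) ≡ true
row-kept {suc _} r fzero    = kept-endB-inner (horiz (inner r) fzero) {r′ = fzero} refl
row-kept r (fsuc j)         = kept-endA-inner (horiz (inner r) (fsuc j)) {r′ = j} refl

column-kept : ∀ {t} (r : Fin t) i → kept (vert i (inner r)) ≡ true
column-kept {suc _} r fzero = kept-endB-inner (vert fzero (inner r)) {r = fzero} refl
column-kept r (fsuc i)      = kept-endA-inner (vert (fsuc i) (inner r)) {r = i} refl

kept-irrelevant : ∀ {t} {e : GEdge t} (p q : kept e ≡ true) → p ≡ q
kept-irrelevant = Decidable⇒UIP.≡-irrelevant _≟ᵇ_

endA≢endB : ∀ {t} (e : GEdge t) → endA e ≢ endB e
endA≢endB (horiz i j) eq = inject₁≢fsuc j (cong proj₂ eq)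
endA≢endB (vert i j)  eq = inject₁≢fsuc i (cong proj₁ eq)

module CrossedGrid (t : ℕ) (k : KEdge t → ℕ) where
  open Crossed t k

  searchable-Seg : Searchable Seg
  searchable-Seg =
    searchable-Σ (searchable-Σ searchable-GEdge (searchable-≡true ∘ kept)) (λ _ → searchable-Fin)

  first last : KEdge t → Seg
  first e = e , fzero
  last e = e , fromℕ (k e)

  rightEnd-inject₁ : ∀ e (q : Fin (k e)) → rightEnd (e , inject₁ q) ≡ inj₂ (e , q)
  rightEnd-inject₁ e q with toℕ (inject₁ q) <? k e
  ... | yes q<k = cong (λ q′ → inj₂ (e , q′)) (toℕ-injective (trans (toℕ-fromℕ< q<k) (toℕ-inject₁ q)))
  ... | no q≮k  = contradiction (inject₁ℕ< q) q≮k

  rightEnd-last : ∀ e → rightEnd (last e) ≡ inj₁ (endB (proj₁ e))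
  rightEnd-last e with toℕ (fromℕ (k e)) <? k e
  ... | yes k<k = contradiction (subst (_< k e) (toℕ-fromℕ (k e)) k<k) (n≮n (k e))
  ... | no _    = refl

  LAdj-sym : ∀ {a b} → LAdj a b → LAdj b a
  LAdj-sym (a≢b , x , ax , bx) = a≢b ∘ sym , x , bx , ax

  consecutive-adjacent : ∀ e (q : Fin (k e)) → LAdj (e , fsuc q) (e , inject₁ q)
  consecutive-adjacent e q =
    (λ eq → inject₁≢fsuc q (sym (toℕ-injective (cong (toℕ ∘ proj₂) eq)))) ,
    inj₂ (e , q) , inj₁ refl , inj₂ (rightEnd-inject₁ e q)

  junction-adjacent : ∀ {e e′} → endB (proj₁ e) ≡ endA (proj₁ e′) → LAdj (first e′) (last e)
  junction-adjacent {e} {e′} meet =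
    (λ eq → endA≢endB (proj₁ e) (sym (subst (λ d → endB (proj₁ e) ≡ endA (proj₁ d)) (cong proj₁ eq) meet))) ,
    inj₁ (endA (proj₁ e′)) , inj₁ refl , inj₂ (trans (rightEnd-last e) (cong inj₁ meet))

  meeting-adjacent : ∀ {e e′} → proj₁ e ≢ proj₁ e′ → endB (proj₁ e) ≡ endB (proj₁ e′) → LAdj (last e) (last e′)
  meeting-adjacent {e} {e′} e≢e′ meet =
    (λ eq → e≢e′ (cong (proj₁ ∘ proj₁) eq)) ,
    inj₁ (endB (proj₁ e)) , inj₂ (rightEnd-last e) , inj₂ (trans (rightEnd-last e′) (cong inj₁ (sym meet)))

  rowEdge columnEdge : Fin t → Fin (suc t) → KEdge t
  rowEdge r j = horiz (inner r) j , row-kept r j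
  columnEdge r i = vert i (inner r) , column-kept r i

  -- Both edges end at the grid point (inner r , inner r′).
  row-meets-column : ∀ r r′ → LAdj (last (rowEdge r (inject₁ r′))) (last (columnEdge r′ (inject₁ r)))
  row-meets-column r r′ = meeting-adjacent (λ ()) refl

  edgeLabel : GEdge t → Maybe (Fin t)
  edgeLabel (horiz i _) = innerIndex i
  edgeLabel (vert _ j)  = innerIndex j

  label : Seg → Maybe (Fin t)
  label ((e , _) , _) = edgeLabel e

  module Class (r : Fin t) where
    InClass : Seg → Set
    InClass s = label s ≡ just r

    _∼_ : Seg → Seg → Set
    _∼_ = Within InClass LAdj

    ∼-sym : ∀ {a b} → a ∼ b → b ∼ a
    ∼-sym (ℓa , ℓb , ab) = ℓb , ℓa , LAdj-sym ab

    along-edge : ∀ e → edgeLabel (proj₁ e) ≡ just r → ∀ p → Star _∼_ (e , p) (first e)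
    along-edge e ℓ = star-chain (e ,_) (λ q → (ℓ , ℓ , consecutive-adjacent e q) ◅ ε)

    along-line : (E : Fin (suc t) → KEdge t) → (∀ j → edgeLabel (proj₁ (E j)) ≡ just r) →
                 (∀ i → endB (proj₁ (E (inject₁ i))) ≡ endA (proj₁ (E (fsuc i)))) →
                 ∀ j p → Star _∼_ (E j , p) (first (E fzero))
    along-line E ℓ link j p =
      along-edge (E j) (ℓ j) p ◅◅
      star-chain (first ∘ E)
        (λ i → (ℓ (fsuc i) , ℓ (inject₁ i) , junction-adjacent (link i)) ◅ along-edge (E (inject₁ i)) (ℓ (inject₁ i)) _) j

    row : ∀ j p → Star _∼_ (rowEdge r j , p) (first (rowEdge r fzero))
    row = along-line (rowEdge r) (λ _ → innerIndex-inner r) (λ _ → refl)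

    column : ∀ i p → Star _∼_ (columnEdge r i , p) (first (columnEdge r fzero))
    column = along-line (columnEdge r) (λ _ → innerIndex-inner r) (λ _ → refl)

    row-to-column : Star _∼_ (first (rowEdge r fzero)) (first (columnEdge r fzero))
    row-to-column =
      reverse ∼-sym (row (inject₁ r) _) ◅◅
      (innerIndex-inner r , innerIndex-inner r , row-meets-column r r) ◅ column (inject₁ r) _

    to-hub : ∀ s → InClass s → Star _∼_ s (first (columnEdge r fzero))
    to-hub ((horiz i j , kp) , p) ℓ with refl ← innerIndex-just i ℓ
                                    with refl ← kept-irrelevant {e = horiz (inner r) j} kp (row-kept r j)
      = row j p ◅◅ row-to-column
    to-hub ((vert i j , kp) , p) ℓ with refl ← innerIndex-just j ℓ
                                   with refl ← kept-irrelevant {e = vert i (inner r)} kp (column-kept r i)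
      = column i p

  model : KMinorModelIn LAdj t
  model = record
    { label     = label
    ; nonempty  = λ r → last (rowEdge r fzero) , innerIndex-inner r
    ; connected = λ r a b ℓa ℓb → let open Class r in to-hub a ℓa ◅◅ reverse ∼-sym (to-hub b ℓb)
    ; touching  = λ r r′ _ → _ , _ , innerIndex-inner r , innerIndex-inner r′ , row-meets-column r r′
    }

n≤n*n : ∀ n → n ≤ n * n
n≤n*n zero    = z≤n
n≤n*n (suc n) = m≤m*n (suc n) (suc n)

lemma7p7 : Σ ℕ λ c → ∀ (t : ℕ) → 1 ≤ t → (G : Graph) → ContainsCrossedGrid G t →
    ∀ (h : ℕ) → IsHw G h → t ≤ c * (h * h)
lemma7p7 = 1 , λ t _ G (k , _ , embedding) h (_ , maximal) →
  let open CrossedGrid t k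
      t≤h = maximal t (kMinor-of-subgraph searchable-Seg embedding model)
  in subst (t ≤_) (sym (*-identityˡ (h * h))) (≤-trans t≤h (n≤n*n h))
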